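{- Let $r,n$ be positive integers and let $I$ be the set of $v\in G(r,n)$ with $v\bar v=1$. For $g\in G(r,n)$ and $v\in I$ put $\phi_g(v)=\zeta_r^{\langle g,v\rangle}(-1)^{\mathrm{inv}_v(g)}$. Then for all $g,h\in G(r,n)$ and $v\in I$, $$\phi_{gh}(v)=\phi_g(|h|v|h|^{ -1})\,\phi_h(v).$$ In particular the map $\varrho:G(r,n)\to GL(M)$, where $M$ has basis $\{C_v:v\in I\}$ and $\varrho(g)C_v=\phi_g(v)C_{|g|v|g|^{ -1}}$, is a group homomorphism.
   Context: $\zeta_r=e^{2\pi i/r}$, $\mathbb Z_r=\mathbb Z/r\mathbb Z$. $G(r,n)$ is the group of colored permutations: $g$ is given by $|g|\in S_n$ and colors $z_1(g),\dots,z_n(g)\in\mathbb Z_r$, acting on $\{\zeta_r^k i\}$ by $g(\zeta_r^k i)=\zeta_r^{k+z_i(g)}|g|(i)$, with product given by composition (equivalently, monomial $n\times n$ matrices with $r$-th roots of unity as nonzero entries). $S_n$ is identified with the elements with all colors $0$. $\bar g$ has $|\bar g|=|g|$ and colors $-z_i(g)$; $v\bar v=1$ iff $|v|^2=1$ and $z_{|v|(i)}(v)=z_i(v)$ for all $i$. $\langle g,v\rangle=\sum_i z_i(g)z_i(v)\in\mathbb Z_r$. For $\sigma,\tau\in S_n$ with $\tau^2=1$: $\mathrm{Inv}(\sigma)=\{\{i,j\}:(j-i)(\sigma(j)-\sigma(i))<0\}$, $\mathrm{Pair}(\tau)=\{\{i,j\}:\tau(i)=j\neq i\}$, $\mathrm{inv}_v(g)=|\mathrm{Inv}(|g|)\cap\mathrm{Pair}(|v|)|$.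 -}

module Defs where

open import Data.Nat using (ℕ; zero; suc; _+_; _*_; _∸_; _<_; NonZero)
open import Data.Nat.DivMod using (_mod_)
open import Data.Fin using (Fin; toℕ)
import Data.Fin as F
open import Data.Fin.Permutation using (Permutation′; _⟨$⟩ʳ_; _⟨$⟩ˡ_; id; flip)
open import Data.List using (List; length; filter; cartesianProduct; allFin; map)
open import Data.Nat.ListAction using (sum)
open import Data.Product using (_×_; _,_; proj₁; proj₂)
open import Relation.Binary.PropositionalEquality using (_≡_)
open import Relation.Nullary using (Dec)
open import Relation.Nullary.Decidable using (_×-dec_)

nz2 : (r : ℕ) → .{{NonZero r}} → NonZero (2 * r)
nz2 (suc r) = _

module ColoredPerm (r n : ℕ) .{{nzr : NonZero r}} where

  Zr : Set
  Zr = Fin r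

  _+r_ : Zr → Zr → Zr
  a +r b = (toℕ a + toℕ b) mod r

  -r_ : Zr → Zr
  -r a = (r ∸ toℕ a) mod r

  0r : Zr
  0r = 0 mod r

  -- An element g of G(r,n): the permutation |g| ∈ S_n and colors z_i(g) ∈ ℤ_r.
  record G : Set where
    constructor mkG
    field
      perm : Permutation′ n
      z   : Fin n → Zr
  open G public

  -- g(ζ^k i) = ζ^{k + z_i(g)} |g|(i); product is composition:
  -- (gh)(ζ^k i) = g(ζ^{k+z_i(h)} |h|(i)) = ζ^{k+z_i(h)+z_{|h|(i)}(g)} |g||h|(i)
  infixl 7 _·_
  _·_ : G → G → G
  g · h = mkG ((perm h) Data.Fin.Permutation.∘ₚ (perm g))
              (λ i → z h i +r z g ((perm h) ⟨$⟩ʳ i))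

  one : G
  one = mkG id (λ _ → 0r)

  ι : Permutation′ n → G
  ι σ = mkG σ (λ _ → 0r)

  bar : G → G
  bar g = mkG (perm g) (λ i → -r z g i)

  infix 4 _≈_
  _≈_ : G → G → Set
  g ≈ h = (i : Fin n) → ((perm g) ⟨$⟩ʳ i ≡ (perm h) ⟨$⟩ʳ i) × (z g i ≡ z h i)

  InI : G → Set
  InI v = (v · bar v) ≈ one

  conj : Permutation′ n → G → G
  conj σ v = (ι σ · v) · ι (flip σ)

  -- ⟨g,v⟩ = Σ_i z_i(g) z_i(v), as a natural number (to be read mod r)
  pairingℕ : G → G → ℕ
  pairingℕ g v = sum (map (λ i → toℕ (z g i) * toℕ (z v i)) (allFin n))

  -- inv_v(g) = |Inv(|g|) ∩ Pair(|v|)| : unordered pairs {i,j} (listed once as i<j)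
  -- with |v|(i) = j and |g|(j) < |g|(i)
  invPair : G → G → Fin n × Fin n → Set
  invPair g v (i , j) =
    (i F.< j) × (((perm v) ⟨$⟩ʳ i ≡ j) × (((perm g) ⟨$⟩ʳ j) F.< ((perm g) ⟨$⟩ʳ i)))

  invPair? : (g v : G) → (p : Fin n × Fin n) → Dec (invPair g v p)
  invPair? g v (i , j) =
    (i F.<? j) ×-dec (((perm v) ⟨$⟩ʳ i F.≟ j) ×-dec (((perm g) ⟨$⟩ʳ j) F.<? ((perm g) ⟨$⟩ʳ i)))

  inv : G → G → ℕ
  inv g v = length (filter (invPair? g v) (cartesianProduct (allFin n) (allFin n)))

  -- 2r-th roots of unity: μ_{2r} ≅ ℤ_{2r}, the element a ∈ Fin (2r) standing for ζ_{2r}^a.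
  -- ζ_r = ζ_{2r}^2 and -1 = ζ_{2r}^r.
  Root : Set
  Root = Fin (2 * r)

  infixl 7 _⊙_
  _⊙_ : Root → Root → Root
  a ⊙ b = _mod_ (toℕ a + toℕ b) (2 * r) {{nz2 r}}

  -- φ_g(v) = ζ_r^{⟨g,v⟩} (-1)^{inv_v(g)} = ζ_{2r}^{2⟨g,v⟩ + r·inv_v(g)}
  φ : G → G → Root
  φ g v = _mod_ (2 * pairingℕ g v + r * inv g v) (2 * r) {{nz2 r}}

module Submission where

-- Writing φ_g(v) = ζ_{2r}^e with e = 2⟨g,v⟩ + r·inv_v(g), the identity becomes
-- e(gh,v) ≡ e(g,v′) + e(h,v) (mod 2r) (exponent-cong), which splits into
--  * a colour part ⟨gh,v⟩ ≡ ⟨g,v′⟩ + ⟨h,v⟩ (mod r) (pairing-cocycle): since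
--    z_i(gh) = z_i(h) + z_{|h|i}(g), this is distributivity once the sum for
--    ⟨g,v′⟩ is reindexed along |h|;
--  * a sign part: inv_v(gh) + inv_{v′}(g) + inv_v(h) is even (inv-parity).
--    For an involution ν of Fin n and permutations α, β, the discord of α and β
--    counts the pairs {i, ν i} that α keeps in order and β reverses.  Counting
--    from both ends of each pair shows it equals the number of pairs on which α
--    and β disagree (discord-pairs), and on any pair the three permutations
--    α, β, γ produce an even number of disagreements (discord-parity).  With
--    ν = |v|, inv_v(g) is the discord of id and |g|, and inv_{v′}(g) is the
--    discord of |h| and |gh|, so the three inversion counts are the discords
--    among id, |h|, |gh|.

open import Data.Bool using (Bool; true; false; _∧_; _∨_; _xor_; not; if_then_else_)
open import Data.Bool.Properties using (∧-zeroʳ; not-involutive)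
open import Data.Fin using (Fin; toℕ)
import Data.Fin as F
import Data.Fin.Properties as FP
open import Data.Fin.Permutation using (Permutation′; _⟨$⟩ʳ_; _⟨$⟩ˡ_; _∘ₚ_; inverseˡ)
import Data.Fin.Permutation as Perm
open import Data.List using (List; []; _∷_; length; filter; cartesianProduct; allFin; map; tabulate; _++_)
open import Data.List.Properties using (map-tabulate; map-++; map-∘)
open import Data.Nat using (ℕ; zero; suc; _+_; _*_; NonZero; >-nonZero⁻¹; _≤_)
open import Data.Nat.DivMod
open import Data.Nat.ListAction using () renaming (sum to listSum)
open import Data.Nat.ListAction.Properties using (sum-++)
open import Data.Nat.Properties
open import Data.Nat.Solver using (module +-*-Solver)
open import Data.Product using (_×_; _,_; Σ; proj₁)
open import Function using (id; _∘_)
open import Relation.Binary using (tri<; tri≈; tri>)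
open import Relation.Binary.PropositionalEquality
open import Relation.Nullary using (does; yes; no; ¬_; contradiction)
open import Relation.Nullary.Decidable using (dec-true; dec-false)
open import Relation.Unary using (Pred; Decidable)
open import Algebra.Properties.Semiring.Sum +-*-semiring
  using (∑-distrib-+; sum-cong-≗; sum-replicate-zero; sum-permute; *-distribˡ-sum) renaming (sum to ∑)
open import Defs

ind : Bool → ℕ
ind true = 1
ind false = 0

listSum-tabulate : ∀ {n} (f : Fin n → ℕ) → listSum (tabulate f) ≡ ∑ f
listSum-tabulate {zero} f = refl
listSum-tabulate {suc n} f = cong (f F.zero +_) (listSum-tabulate (λ i → f (F.suc i)))

listSum-allFin : ∀ {n} (f : Fin n → ℕ) → listSum (map f (allFin n)) ≡ ∑ f
listSum-allFin f = trans (cong listSum (map-tabulate id f)) (listSum-tabulate f)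

∑-delta : ∀ {n} (a : Fin n) (f : Fin n → ℕ) → ∑ (λ j → if does (a F.≟ j) then f j else 0) ≡ f a
∑-delta {suc n} F.zero f = trans (cong (f F.zero +_) (sum-replicate-zero n)) (+-identityʳ (f F.zero))
∑-delta {suc n} (F.suc a) f = ∑-delta a (λ j → f (F.suc j))

∑-mod : ∀ {n} r .{{_ : NonZero r}} (f g : Fin n → ℕ) → (∀ i → f i % r ≡ g i % r) → ∑ f % r ≡ ∑ g % r
∑-mod {zero} r f g e = refl
∑-mod {suc n} r f g e = begin
  (f F.zero + ∑ (λ i → f (F.suc i))) % r                   ≡⟨ %-distribˡ-+ (f F.zero) _ r ⟩
  (f F.zero % r + ∑ (λ i → f (F.suc i)) % r) % r           ≡⟨ cong₂ (λ x y → (x + y) % r) (e F.zero) (∑-mod r _ _ (λ i → e (F.suc i))) ⟩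
  (g F.zero % r + ∑ (λ i → g (F.suc i)) % r) % r           ≡⟨ %-distribˡ-+ (g F.zero) _ r ⟨
  (g F.zero + ∑ (λ i → g (F.suc i))) % r                   ∎
  where open ≡-Reasoning

length-filter : ∀ {a p} {A : Set a} {P : Pred A p} (P? : Decidable P) (xs : List A) →
  length (filter P? xs) ≡ listSum (map (λ x → ind (does (P? x))) xs)
length-filter P? [] = refl
length-filter P? (x ∷ xs) with does (P? x)
... | true = cong suc (length-filter P? xs)
... | false = length-filter P? xs

listSum-cartesianProduct : ∀ {a b} {A : Set a} {B : Set b} (f : A × B → ℕ) (xs : List A) (ys : List B) →
  listSum (map f (cartesianProduct xs ys)) ≡ listSum (map (λ x → listSum (map (λ y → f (x , y)) ys)) xs)
listSum-cartesianProduct f [] ys = refl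
listSum-cartesianProduct f (x ∷ xs) ys = begin
  listSum (map f (map (x ,_) ys ++ cartesianProduct xs ys))
    ≡⟨ cong listSum (map-++ f (map (x ,_) ys) _) ⟩
  listSum (map f (map (x ,_) ys) ++ map f (cartesianProduct xs ys))
    ≡⟨ sum-++ (map f (map (x ,_) ys)) _ ⟩
  listSum (map f (map (x ,_) ys)) + listSum (map f (cartesianProduct xs ys))
    ≡⟨ cong₂ _+_ (cong listSum (sym (map-∘ ys))) (listSum-cartesianProduct f xs ys) ⟩
  listSum (map (λ y → f (x , y)) ys) + listSum (map (λ x → listSum (map (λ y → f (x , y)) ys)) xs) ∎
  where open ≡-Reasoning

lt : ∀ {n} → Fin n → Fin n → Bool
lt a b = does (a F.<? b)

lt-refl : ∀ {n} (a : Fin n) → lt a a ≡ false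
lt-refl a = dec-false (a F.<? a) (FP.<-irrefl refl)

lt-flip : ∀ {n} {a b : Fin n} → ¬ a ≡ b → lt b a ≡ not (lt a b)
lt-flip {a = a} {b} a≢b with FP.<-cmp a b
... | tri< a<b _ b≮a = trans (dec-false (b F.<? a) b≮a) (cong not (sym (dec-true (a F.<? b) a<b)))
... | tri≈ _ a≡b _ = contradiction a≡b a≢b
... | tri> a≮b _ b<a = trans (dec-true (b F.<? a) b<a) (cong not (sym (dec-false (a F.<? b) a≮b)))

⟨$⟩ʳ-injective : ∀ {n} (π : Permutation′ n) {a b : Fin n} → π ⟨$⟩ʳ a ≡ π ⟨$⟩ʳ b → a ≡ b
⟨$⟩ʳ-injective π {a} {b} e = trans (sym (inverseˡ π)) (trans (cong (π ⟨$⟩ˡ_) e) (inverseˡ π))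

keep-reverse : ∀ {n} (α β : Permutation′ n) (a b : Fin n) →
  ind (lt (α ⟨$⟩ʳ a) (α ⟨$⟩ʳ b) ∧ lt (β ⟨$⟩ʳ b) (β ⟨$⟩ʳ a))
    + ind (lt (α ⟨$⟩ʳ b) (α ⟨$⟩ʳ a) ∧ lt (β ⟨$⟩ʳ a) (β ⟨$⟩ʳ b))
  ≡ ind (lt (α ⟨$⟩ʳ a) (α ⟨$⟩ʳ b) xor lt (β ⟨$⟩ʳ a) (β ⟨$⟩ʳ b))
keep-reverse α β a b with a F.≟ b
... | yes refl rewrite lt-refl (α ⟨$⟩ʳ a) | lt-refl (β ⟨$⟩ʳ a) = refl
... | no a≢b
  rewrite lt-flip {a = α ⟨$⟩ʳ a} (a≢b ∘ ⟨$⟩ʳ-injective α)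
        | lt-flip {a = β ⟨$⟩ʳ a} (a≢b ∘ ⟨$⟩ʳ-injective β)
  = one-of (lt (α ⟨$⟩ʳ a) (α ⟨$⟩ʳ b)) (lt (β ⟨$⟩ʳ a) (β ⟨$⟩ʳ b))
  where
  one-of : ∀ x y → ind (x ∧ not y) + ind (not x ∧ y) ≡ ind (x xor y)
  one-of true true = refl
  one-of true false = refl
  one-of false true = refl
  one-of false false = refl

xor-triangle : ∀ x y z → ind (x xor z) + ind (y xor z) + ind (x xor y) ≡ 2 * ind ((x xor y) ∨ (y xor z))
xor-triangle true true true = refl
xor-triangle true true false = refl
xor-triangle true false true = refl
xor-triangle true false false = refl
xor-triangle false true true = refl
xor-triangle false true false = refl
xor-triangle false false true = refl
xor-triangle false false false = refl

-- Pair counting relative to a permutation ν of Fin n; the counting lemmas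
-- assume that ν is an involution, so that Fin n splits into pairs {i, ν i}.
module Pairs {n} (ν : Permutation′ n) where

  lower : Fin n → Bool
  lower i = lt i (ν ⟨$⟩ʳ i)

  keeps : Permutation′ n → Fin n → Bool
  keeps α i = lt (α ⟨$⟩ʳ i) (α ⟨$⟩ʳ (ν ⟨$⟩ʳ i))

  discord : Permutation′ n → Permutation′ n → ℕ
  discord α β = ∑ (λ i → ind (keeps α i ∧ lt (β ⟨$⟩ʳ (ν ⟨$⟩ʳ i)) (β ⟨$⟩ʳ i)))

  module _ (ν-invol : ∀ i → ν ⟨$⟩ʳ (ν ⟨$⟩ʳ i) ≡ i) where

    -- A ν-invariant property that fails at fixed points holds at both points of
    -- each pair, so counting it over all points counts the pairs twice.
    count-pairs : (d : Fin n → Bool) → (∀ i → d (ν ⟨$⟩ʳ i) ≡ d i) → (∀ i → ν ⟨$⟩ʳ i ≡ i → d i ≡ false) →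
      ∑ (λ i → ind (d i)) ≡ 2 * ∑ (λ i → ind (lower i ∧ d i))
    count-pairs d d-inv d-fix = begin
      ∑ (λ i → ind (d i))                               ≡⟨ sum-cong-≗ one-end ⟩
      ∑ (λ i → half i + half (ν ⟨$⟩ʳ i))                 ≡⟨ ∑-distrib-+ half _ ⟩
      ∑ half + ∑ (λ i → half (ν ⟨$⟩ʳ i))                 ≡⟨ cong (∑ half +_) (sum-permute half ν) ⟨
      ∑ half + ∑ half                                   ≡⟨ cong (∑ half +_) (+-identityʳ _) ⟨
      2 * ∑ half                                        ∎
      where
      open ≡-Reasoning
      half : Fin n → ℕ
      half i = ind (lower i ∧ d i)
      split : ∀ l e → ind e ≡ ind (l ∧ e) + ind (not l ∧ e)
      split true true = refl
      split true false = refl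
      split false true = refl
      split false false = refl
      one-end : ∀ i → ind (d i) ≡ half i + half (ν ⟨$⟩ʳ i)
      one-end i with ν ⟨$⟩ʳ i F.≟ i
      ... | yes fixed rewrite d-inv i | d-fix i fixed | ∧-zeroʳ (lower i) | ∧-zeroʳ (lower (ν ⟨$⟩ʳ i)) = refl
      ... | no moved rewrite d-inv i | ν-invol i | lt-flip {a = i} (moved ∘ sym) = split (lower i) (d i)

    disagree-invariant : ∀ α β i → (keeps α (ν ⟨$⟩ʳ i) xor keeps β (ν ⟨$⟩ʳ i)) ≡ (keeps α i xor keeps β i)
    disagree-invariant α β i with ν ⟨$⟩ʳ i F.≟ i
    ... | yes fixed = cong (λ j → keeps α j xor keeps β j) fixed
    ... | no moved
      rewrite ν-invol i
            | lt-flip {a = α ⟨$⟩ʳ i} (moved ∘ sym ∘ ⟨$⟩ʳ-injective α)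
            | lt-flip {a = β ⟨$⟩ʳ i} (moved ∘ sym ∘ ⟨$⟩ʳ-injective β)
      = not-xor-not (keeps α i) (keeps β i)
      where
      not-xor-not : ∀ x y → (not x xor not y) ≡ (x xor y)
      not-xor-not true y = refl
      not-xor-not false y = not-involutive y

    disagree-fixed : ∀ α β i → ν ⟨$⟩ʳ i ≡ i → (keeps α i xor keeps β i) ≡ false
    disagree-fixed α β i fixed rewrite fixed | lt-refl (α ⟨$⟩ʳ i) | lt-refl (β ⟨$⟩ʳ i) = refl

    -- Counting each pair from both ends: twice the discord is the number of
    -- points at which α and β disagree.
    double-discord : ∀ α β → 2 * discord α β ≡ ∑ (λ i → ind (keeps α i xor keeps β i))
    double-discord α β = begin
      2 * discord α β                                  ≡⟨ cong (discord α β +_) (+-identityʳ _) ⟩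
      discord α β + discord α β                        ≡⟨ cong (discord α β +_) (sum-permute term ν) ⟩
      discord α β + ∑ (λ i → term (ν ⟨$⟩ʳ i))           ≡⟨ ∑-distrib-+ term _ ⟨
      ∑ (λ i → term i + term (ν ⟨$⟩ʳ i))                ≡⟨ sum-cong-≗ both-ends ⟩
      ∑ (λ i → ind (keeps α i xor keeps β i))          ∎
      where
      open ≡-Reasoning
      term : Fin n → ℕ
      term i = ind (keeps α i ∧ lt (β ⟨$⟩ʳ (ν ⟨$⟩ʳ i)) (β ⟨$⟩ʳ i))
      both-ends : ∀ i → term i + term (ν ⟨$⟩ʳ i) ≡ ind (keeps α i xor keeps β i)
      both-ends i rewrite ν-invol i = keep-reverse α β i (ν ⟨$⟩ʳ i)

    discord-pairs : ∀ α β → discord α β ≡ ∑ (λ i → ind (lower i ∧ (keeps α i xor keeps β i)))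
    discord-pairs α β = *-cancelˡ-≡ _ _ 2 (trans (double-discord α β)
      (count-pairs (λ i → keeps α i xor keeps β i) (disagree-invariant α β) (disagree-fixed α β)))

    discord-parity : ∀ α β γ → Σ ℕ λ K → discord α γ + discord β γ + discord α β ≡ 2 * K
    discord-parity α β γ = ∑ odd-one-out , (begin
      discord α γ + discord β γ + discord α β
        ≡⟨ cong₂ _+_ (cong₂ _+_ (discord-pairs α γ) (discord-pairs β γ)) (discord-pairs α β) ⟩
      ∑ (pairs x z) + ∑ (pairs y z) + ∑ (pairs x y)
        ≡⟨ cong (_+ ∑ (pairs x y)) (∑-distrib-+ (pairs x z) (pairs y z)) ⟨
      ∑ (λ i → pairs x z i + pairs y z i) + ∑ (pairs x y)
        ≡⟨ ∑-distrib-+ (λ i → pairs x z i + pairs y z i) (pairs x y) ⟨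
      ∑ (λ i → pairs x z i + pairs y z i + pairs x y i)
        ≡⟨ sum-cong-≗ (λ i → lower-triangle (lower i) (x i) (y i) (z i)) ⟩
      ∑ (λ i → 2 * odd-one-out i)
        ≡⟨ *-distribˡ-sum 2 odd-one-out ⟨
      2 * ∑ odd-one-out ∎)
      where
      open ≡-Reasoning
      x y z : Fin n → Bool
      x = keeps α
      y = keeps β
      z = keeps γ
      pairs : (Fin n → Bool) → (Fin n → Bool) → Fin n → ℕ
      pairs p q i = ind (lower i ∧ (p i xor q i))
      odd-one-out : Fin n → ℕ
      odd-one-out i = ind (lower i ∧ ((x i xor y i) ∨ (y i xor z i)))
      lower-triangle : ∀ l a b c →
        ind (l ∧ (a xor c)) + ind (l ∧ (b xor c)) + ind (l ∧ (a xor b)) ≡ 2 * ind (l ∧ ((a xor b) ∨ (b xor c)))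
      lower-triangle true a b c = xor-triangle a b c
      lower-triangle false a b c = refl

toℕ-mod : ∀ a d .{{_ : NonZero d}} → toℕ (a mod d) ≡ a % d
toℕ-mod a d = FP.toℕ-fromℕ< (m%n<n a d)

mod-cong : ∀ {a b} d .{{_ : NonZero d}} → a % d ≡ b % d → a mod d ≡ b mod d
mod-cong {a} {b} d e = FP.toℕ-injective (trans (toℕ-mod a d) (trans e (sym (toℕ-mod b d))))

%-*-absorb : ∀ a b d .{{_ : NonZero d}} → (a % d * b) % d ≡ (a * b) % d
%-*-absorb a b d = begin
  (a % d * b) % d              ≡⟨ %-distribˡ-* (a % d) b d ⟩
  (a % d % d * (b % d)) % d    ≡⟨ cong (λ x → (x * (b % d)) % d) (m%n%n≡m%n a d) ⟩
  (a % d * (b % d)) % d        ≡⟨ %-distribˡ-* a b d ⟨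
  (a * b) % d                  ∎
  where open ≡-Reasoning

double-mod : ∀ r .{{_ : NonZero r}} .{{_ : NonZero (2 * r)}} a b →
  a % r ≡ b % r → (2 * a) % (2 * r) ≡ (2 * b) % (2 * r)
double-mod r a b e = begin
  (2 * a) % (2 * r)           ≡⟨ reduce a ⟩
  (2 * (a % r)) % (2 * r)     ≡⟨ cong (λ x → (2 * x) % (2 * r)) e ⟩
  (2 * (b % r)) % (2 * r)     ≡⟨ reduce b ⟨
  (2 * b) % (2 * r)           ∎
  where
  open ≡-Reasoning
  open +-*-Solver
  reduce : ∀ x → (2 * x) % (2 * r) ≡ (2 * (x % r)) % (2 * r)
  reduce x = begin
    (2 * x) % (2 * r)                              ≡⟨ cong (λ y → (2 * y) % (2 * r)) (m≡m%n+[m/n]*n x r) ⟩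
    (2 * (x % r + x / r * r)) % (2 * r)            ≡⟨ cong (_% (2 * r)) (solve 3 (λ u k r → con 2 :* (u :+ k :* r) := con 2 :* u :+ k :* (con 2 :* r)) refl (x % r) (x / r) r) ⟩
    (2 * (x % r) + x / r * (2 * r)) % (2 * r)      ≡⟨ [m+kn]%n≡m%n (2 * (x % r)) (x / r) (2 * r) ⟩
    (2 * (x % r)) % (2 * r)                        ∎

-- Modulo 2r, the multiple r·m only depends on the parity of m.
half-period : ∀ r .{{_ : NonZero (2 * r)}} m₁ m₂ m₃ K →
  m₁ + m₂ + m₃ ≡ 2 * K → (r * m₁) % (2 * r) ≡ (r * (m₂ + m₃)) % (2 * r)
half-period r m₁ m₂ m₃ K even = begin
  (r * m₁) % (2 * r)                       ≡⟨ [m+kn]%n≡m%n (r * m₁) K (2 * r) ⟨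
  (r * m₁ + K * (2 * r)) % (2 * r)         ≡⟨ cong (_% (2 * r)) shift ⟩
  (r * (m₂ + m₃) + m₁ * (2 * r)) % (2 * r) ≡⟨ [m+kn]%n≡m%n (r * (m₂ + m₃)) m₁ (2 * r) ⟩
  (r * (m₂ + m₃)) % (2 * r)                ∎
  where
  open ≡-Reasoning
  open +-*-Solver
  shift : r * m₁ + K * (2 * r) ≡ r * (m₂ + m₃) + m₁ * (2 * r)
  shift = begin
    r * m₁ + K * (2 * r)               ≡⟨ solve 3 (λ r m K → r :* m :+ K :* (con 2 :* r) := r :* m :+ r :* (con 2 :* K)) refl r m₁ K ⟩
    r * m₁ + r * (2 * K)               ≡⟨ cong (λ x → r * m₁ + r * x) even ⟨
    r * m₁ + r * (m₁ + m₂ + m₃)        ≡⟨ solve 4 (λ r a b c → r :* a :+ r :* (a :+ b :+ c) := r :* (b :+ c) :+ a :* (con 2 :* r)) refl r m₁ m₂ m₃ ⟩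
    r * (m₂ + m₃) + m₁ * (2 * r)       ∎

exponent-cong : ∀ r .{{_ : NonZero r}} .{{_ : NonZero (2 * r)}} p₁ p₂ p₃ m₁ m₂ m₃ →
  p₁ % r ≡ (p₂ + p₃) % r → Σ ℕ (λ K → m₁ + m₂ + m₃ ≡ 2 * K) →
  (2 * p₁ + r * m₁) % (2 * r) ≡ ((2 * p₂ + r * m₂) + (2 * p₃ + r * m₃)) % (2 * r)
exponent-cong r p₁ p₂ p₃ m₁ m₂ m₃ colours (K , even) = begin
  (2 * p₁ + r * m₁) % d                                  ≡⟨ %-distribˡ-+ (2 * p₁) (r * m₁) d ⟩
  ((2 * p₁) % d + (r * m₁) % d) % d                      ≡⟨ cong₂ (λ x y → (x + y) % d) (double-mod r p₁ (p₂ + p₃) colours) (half-period r m₁ m₂ m₃ K even) ⟩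
  ((2 * (p₂ + p₃)) % d + (r * (m₂ + m₃)) % d) % d        ≡⟨ %-distribˡ-+ (2 * (p₂ + p₃)) (r * (m₂ + m₃)) d ⟨
  (2 * (p₂ + p₃) + r * (m₂ + m₃)) % d                    ≡⟨ cong (_% d) (solve 5 (λ r p q m k → con 2 :* (p :+ q) :+ r :* (m :+ k) := (con 2 :* p :+ r :* m) :+ (con 2 :* q :+ r :* k)) refl r p₂ p₃ m₂ m₃) ⟩
  ((2 * p₂ + r * m₂) + (2 * p₃ + r * m₃)) % d            ∎
  where
  open ≡-Reasoning
  open +-*-Solver
  d : ℕ
  d = 2 * r

module Cocycle (r n : ℕ) .{{_ : NonZero r}} where
  open ColoredPerm r n
  open Pairs using (discord; discord-parity)

  private instance
    nonZero-2r : NonZero (2 * r)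
    nonZero-2r = nz2 r

  toℕ-reduced : (a : Zr) → toℕ a % r ≡ toℕ a
  toℕ-reduced a = m<n⇒m%n≡m (FP.toℕ<n a)

  toℕ-0r : toℕ 0r ≡ 0
  toℕ-0r = trans (toℕ-mod 0 r) (m<n⇒m%n≡m (>-nonZero⁻¹ r))

  +r-identityˡ : ∀ a → 0r +r a ≡ a
  +r-identityˡ a = FP.toℕ-injective (begin
    toℕ (0r +r a)             ≡⟨ toℕ-mod (toℕ 0r + toℕ a) r ⟩
    (toℕ 0r + toℕ a) % r      ≡⟨ cong (λ x → (x + toℕ a) % r) toℕ-0r ⟩
    toℕ a % r                 ≡⟨ toℕ-reduced a ⟩
    toℕ a                     ∎)
    where open ≡-Reasoning

  +r-identityʳ : ∀ a → a +r 0r ≡ a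
  +r-identityʳ a = FP.toℕ-injective (begin
    toℕ (a +r 0r)             ≡⟨ toℕ-mod (toℕ a + toℕ 0r) r ⟩
    (toℕ a + toℕ 0r) % r      ≡⟨ cong (λ x → (toℕ a + x) % r) toℕ-0r ⟩
    (toℕ a + 0) % r           ≡⟨ cong (_% r) (+-identityʳ (toℕ a)) ⟩
    toℕ a % r                 ≡⟨ toℕ-reduced a ⟩
    toℕ a                     ∎)
    where open ≡-Reasoning

  conj-colour : ∀ σ v i → z (conj σ v) i ≡ z v (σ ⟨$⟩ˡ i)
  conj-colour σ v i = trans (+r-identityˡ _) (+r-identityʳ _)

  involution : ∀ {v} → InI v → ∀ i → perm v ⟨$⟩ʳ (perm v ⟨$⟩ʳ i) ≡ i
  involution vI i = proj₁ (vI i)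

  colour : G → Fin n → ℕ
  colour g i = toℕ (z g i)

  pairing-∑ : ∀ g v → pairingℕ g v ≡ ∑ (λ i → colour g i * colour v i)
  pairing-∑ g v = listSum-allFin (λ i → colour g i * colour v i)

  pairing-conj : ∀ σ g v → pairingℕ g (conj σ v) ≡ ∑ (λ i → colour g (σ ⟨$⟩ʳ i) * colour v i)
  pairing-conj σ g v = begin
    pairingℕ g (conj σ v)                              ≡⟨ pairing-∑ g (conj σ v) ⟩
    ∑ (λ i → colour g i * colour (conj σ v) i)         ≡⟨ sum-cong-≗ (λ i → cong (λ c → colour g i * toℕ c) (conj-colour σ v i)) ⟩
    ∑ (λ i → colour g i * colour v (σ ⟨$⟩ˡ i))          ≡⟨ sum-permute _ σ ⟩
    ∑ (λ i → colour g (σ ⟨$⟩ʳ i) * colour v (σ ⟨$⟩ˡ (σ ⟨$⟩ʳ i)))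
      ≡⟨ sum-cong-≗ (λ i → cong (λ j → colour g (σ ⟨$⟩ʳ i) * colour v j) (inverseˡ σ)) ⟩
    ∑ (λ i → colour g (σ ⟨$⟩ʳ i) * colour v i)          ∎
    where open ≡-Reasoning

  -- Colour part of the cocycle identity: ⟨gh,v⟩ ≡ ⟨g,v'⟩ + ⟨h,v⟩ (mod r),
  -- because z_i(gh) = z_i(h) + z_{|h| i}(g) in ℤ_r.
  pairing-cocycle : ∀ g h v → pairingℕ (g · h) v % r ≡ (pairingℕ g (conj (perm h) v) + pairingℕ h v) % r
  pairing-cocycle g h v = begin
    pairingℕ (g · h) v % r                                     ≡⟨ cong (_% r) (pairing-∑ (g · h) v) ⟩
    ∑ (λ i → colour (g · h) i * colour v i) % r                ≡⟨ ∑-mod r _ _ (λ i → colour-mod i) ⟩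
    ∑ (λ i → (colour h i + colour g (H i)) * colour v i) % r   ≡⟨ cong (_% r) (sum-cong-≗ λ i → distrib i) ⟩
    ∑ (λ i → colour g (H i) * colour v i + colour h i * colour v i) % r
      ≡⟨ cong (_% r) (∑-distrib-+ (λ i → colour g (H i) * colour v i) _) ⟩
    (∑ (λ i → colour g (H i) * colour v i) + ∑ (λ i → colour h i * colour v i)) % r
      ≡⟨ cong₂ (λ x y → (x + y) % r) (pairing-conj (perm h) g v) (pairing-∑ h v) ⟨
    (pairingℕ g (conj (perm h) v) + pairingℕ h v) % r          ∎
    where
    open ≡-Reasoning
    H : Fin n → Fin n
    H i = perm h ⟨$⟩ʳ i
    colour-mod : ∀ i → (colour (g · h) i * colour v i) % r ≡ ((colour h i + colour g (H i)) * colour v i) % r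
    colour-mod i = trans (cong (λ x → (x * colour v i) % r) (toℕ-mod (colour h i + colour g (H i)) r))
                         (%-*-absorb (colour h i + colour g (H i)) (colour v i) r)
    distrib : ∀ i → (colour h i + colour g (H i)) * colour v i ≡ colour g (H i) * colour v i + colour h i * colour v i
    distrib i = trans (*-distribʳ-+ (colour v i) (colour h i) _) (+-comm (colour h i * colour v i) _)

  -- inv_v(g) is the discord of the identity and |g| relative to |v|: a pair
  -- {i < j} with |v| i = j is an inversion of |g| exactly when |g| reverses it.
  inv-discord : ∀ g v → inv g v ≡ discord (perm v) Perm.id (perm g)
  inv-discord g v = begin
    inv g v
      ≡⟨ length-filter (invPair? g v) (cartesianProduct (allFin n) (allFin n)) ⟩
    listSum (map cell (cartesianProduct (allFin n) (allFin n)))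
      ≡⟨ listSum-cartesianProduct cell (allFin n) (allFin n) ⟩
    listSum (map (λ i → listSum (map (λ j → cell (i , j)) (allFin n))) (allFin n))
      ≡⟨ listSum-allFin (λ i → listSum (map (λ j → cell (i , j)) (allFin n))) ⟩
    ∑ (λ i → listSum (map (λ j → cell (i , j)) (allFin n)))
      ≡⟨ sum-cong-≗ (λ i → listSum-allFin (λ j → cell (i , j))) ⟩
    ∑ (λ i → ∑ (λ j → cell (i , j)))
      ≡⟨ sum-cong-≗ (λ i → trans (sum-cong-≗ (partner i)) (∑-delta (V i) (λ j → reversed i j))) ⟩
    ∑ (λ i → reversed i (V i))
      ∎
    where
    open ≡-Reasoning
    V : Fin n → Fin n
    V i = perm v ⟨$⟩ʳ i
    cell : Fin n × Fin n → ℕ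
    cell p = ind (does (invPair? g v p))
    reversed : Fin n → Fin n → ℕ
    reversed i j = ind (lt i j ∧ lt (perm g ⟨$⟩ʳ j) (perm g ⟨$⟩ʳ i))
    partner : ∀ i j → cell (i , j) ≡ (if does (V i F.≟ j) then reversed i j else 0)
    partner i j with V i F.≟ j
    ... | yes _ = refl
    ... | no _ = cong ind (∧-zeroʳ (lt i j))

  -- Conjugating v by σ amounts to reading the pairs of |v| through σ.
  inv-conj : ∀ σ g v → inv g (conj σ v) ≡ discord (perm v) σ (σ ∘ₚ perm g)
  inv-conj σ g v = begin
    inv g (conj σ v)                                    ≡⟨ inv-discord g (conj σ v) ⟩
    ∑ (λ i → reversed i (σ ⟨$⟩ˡ i))                      ≡⟨ sum-permute _ σ ⟩
    ∑ (λ i → reversed (σ ⟨$⟩ʳ i) (σ ⟨$⟩ˡ (σ ⟨$⟩ʳ i)))      ≡⟨ sum-cong-≗ (λ i → cong (reversed (σ ⟨$⟩ʳ i)) (inverseˡ σ)) ⟩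
    ∑ (λ i → reversed (σ ⟨$⟩ʳ i) i)                      ∎
    where
    open ≡-Reasoning
    -- the summand at k, whose partner under |conj σ v| is σ(|v| j) for j = σ⁻¹ k
    reversed : Fin n → Fin n → ℕ
    reversed k j = ind (lt k (σ ⟨$⟩ʳ (perm v ⟨$⟩ʳ j)) ∧ lt (perm g ⟨$⟩ʳ (σ ⟨$⟩ʳ (perm v ⟨$⟩ʳ j))) (perm g ⟨$⟩ʳ k))

  inv-parity : ∀ g h v → InI v →
    Σ ℕ λ K → inv (g · h) v + inv g (conj (perm h) v) + inv h v ≡ 2 * K
  inv-parity g h v vI
    rewrite inv-discord (g · h) v | inv-conj (perm h) g v | inv-discord h v
    = discord-parity (perm v) (involution {v} vI) Perm.id (perm h) (perm h ∘ₚ perm g)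

  exponent : G → G → ℕ
  exponent g v = 2 * pairingℕ g v + r * inv g v

  mod-⊙ : ∀ a b → (a mod (2 * r)) ⊙ (b mod (2 * r)) ≡ (a + b) mod (2 * r)
  mod-⊙ a b = mod-cong (2 * r) (begin
    (toℕ (a mod (2 * r)) + toℕ (b mod (2 * r))) % (2 * r)
      ≡⟨ cong₂ (λ x y → (x + y) % (2 * r)) (toℕ-mod a (2 * r)) (toℕ-mod b (2 * r)) ⟩
    (a % (2 * r) + b % (2 * r)) % (2 * r)
      ≡⟨ %-distribˡ-+ a b (2 * r) ⟨
    (a + b) % (2 * r) ∎)
    where open ≡-Reasoning

  φ-cocycle : ∀ g h v → InI v → φ (g · h) v ≡ φ g (conj (perm h) v) ⊙ φ h v
  φ-cocycle g h v vI = begin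
    φ (g · h) v                                  ≡⟨ mod-cong (2 * r) exponents ⟩
    (exponent g v′ + exponent h v) mod (2 * r)   ≡⟨ mod-⊙ (exponent g v′) (exponent h v) ⟨
    φ g v′ ⊙ φ h v                               ∎
    where
    open ≡-Reasoning
    v′ : G
    v′ = conj (perm h) v
    exponents : exponent (g · h) v % (2 * r) ≡ (exponent g v′ + exponent h v) % (2 * r)
    exponents = exponent-cong r (pairingℕ (g · h) v) (pairingℕ g v′) (pairingℕ h v)
                                (inv (g · h) v) (inv g v′) (inv h v)
                                (pairing-cocycle g h v) (inv-parity g h v vI)

  conj-∘ : ∀ g h v → conj (perm (g · h)) v ≈ conj (perm g) (conj (perm h) v)
  conj-∘ g h v i = refl , (begin
    z (conj (perm (g · h)) v) i                     ≡⟨ conj-colour (perm (g · h)) v i ⟩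
    z v (perm h ⟨$⟩ˡ (perm g ⟨$⟩ˡ i))                 ≡⟨ conj-colour (perm h) v _ ⟨
    z (conj (perm h) v) (perm g ⟨$⟩ˡ i)              ≡⟨ conj-colour (perm g) (conj (perm h) v) i ⟨
    z (conj (perm g) (conj (perm h) v)) i           ∎)
    where open ≡-Reasoning

proposition3p4 : (r n : ℕ) → .{{nzr : NonZero r}} → 1 ≤ n →
    let open ColoredPerm r n in
    (g h v : G) → InI v →
    (φ (g · h) v ≡ φ g (conj (perm h) v) ⊙ φ h v)
    × (conj (perm (g · h)) v ≈ conj (perm g) (conj (perm h) v))
proposition3p4 r n _ g h v vI = Cocycle.φ-cocycle r n g h v vI , Cocycle.conj-∘ r n g h v
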